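{- Let $d \geq 3$ and $\psi_{\mathbf{a}} \in \mathscr{P}_d$. For any $z \in \mathbb{Q}$, \[ \hat{h}_{\psi_{\mathbf{a}}}(z) - h(z) \geq -\frac{1}{2} \log \mathscr{H}(\psi_{\mathbf{a}}) - \log d. \]
   Context: Let $d \geq 2$. Let $\mathscr{P}_d$ be the set of polynomials $\psi_{\mathbf{a}} \in \mathbb{Q}[z]$ indexed by $\mathbf{a} = (a_d, a_{d-2}, \dots, a_1, a_0) \in \mathbb{Z}^d$ with $\gcd(a_d,a_{d-2},\dots,a_0)=1$, $a_d \neq 0$, $a_0 > 0$, where $\psi_{\mathbf{a}}(z) = \frac{a_d}{a_0} z^d + \frac{a_{d-2}}{a_0} z^{d-2} + \cdots + \frac{a_1}{a_0} z + 1$, and $\mathscr{H}(\psi_{\mathbf{a}}) = \max\{|a_d|, |a_{d-2}|, \dots, |a_1|, a_0\}$. Let $h$ be the logarithmic Weil height on $\mathbb{Q}$, $h(x/y)=\log\max\{|x|,|y|\}$ for coprime $x,y$, and $\hat{h}_{\psi_{\mathbf{a}}}(z) = \lim_{n \to \infty} d^{ -n} h(\psi_{\mathbf{a}}^n(z))$ the canonical height ($\psi^n$ the $n$-th iterate). -}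

module Defs where

open import Data.Nat as ℕ using (ℕ; zero; suc)
open import Data.Integer as ℤ using (ℤ; +_; -[1+_])
open import Data.Rational as ℚ using (ℚ)
open import Data.Fin as Fin using (Fin)
open import Data.Nat.Divisibility using (_∣_)
open import Relation.Binary.PropositionalEquality using (_≡_)
open import Relation.Nullary using (¬_)

iter : {A : Set} → (A → A) → ℕ → A → A
iter f zero    x = x
iter f (suc n) x = f (iter f n x)

powℚ : ℚ → ℕ → ℚ
powℚ z zero    = ℚ.1ℚ
powℚ z (suc n) = z ℚ.* powℚ z n

sumFin : (n : ℕ) → (Fin n → ℚ) → ℚ
sumFin zero    f = ℚ.0ℚ
sumFin (suc n) f = f Fin.zero ℚ.+ sumFin n (λ i → f (Fin.suc i))

-- x / y as a rational, for y > 0 (value 0 when y ≤ 0; never used, since a₀ > 0 is assumed)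
divℤ : ℤ → ℤ → ℚ
divℤ x (+ zero)    = ℚ.0ℚ
divℤ x (+ suc m)   = x ℚ./ suc m
divℤ x -[1+ m ]    = ℚ.0ℚ

ψ : (d : ℕ) → (Fin (suc d) → ℤ) → ℚ → ℚ
ψ d a z = sumFin (suc d) (λ i → divℤ (a i) (a Fin.zero) ℚ.* powℚ z (Fin.toℕ i))

Hℚ : ℚ → ℕ
Hℚ q = ℤ.∣ ℚ.numerator q ∣ ℕ.⊔ ℚ.denominatorℕ q

maxFin : (n : ℕ) → (Fin n → ℕ) → ℕ
maxFin zero    f = 0
maxFin (suc n) f = f Fin.zero ℕ.⊔ maxFin n (λ i → f (Fin.suc i))

-- 𝓗(ψ_a) = max_i |aᵢ|  (a_{d-1} = 0 and a₀ > 0, so this is max{|a_d|,…,|a_1|,a₀})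
Hψ : (d : ℕ) → (Fin (suc d) → ℤ) → ℕ
Hψ d a = maxFin (suc d) (λ i → ℤ.∣ a i ∣)

record Admissible (d : ℕ) (a : Fin (suc d) → ℤ) : Set where
  field
    gap     : ∀ i → Fin.toℕ i ≡ d ℕ.∸ 1 → a i ≡ + 0
    lead    : ¬ (a (Fin.fromℕ d) ≡ + 0)
    a₀-pos  : ℤ.+0 ℤ.< a Fin.zero
    coprime : ∀ (m : ℕ) → (∀ i → m ∣ ℤ.∣ a i ∣) → m ≡ 1

module Submission where

-- Write z = x / y in lowest terms and F for the homogenisation of a₀ ψ, so that
-- ψ (x / y) = F (x , y) / (a₀ yᵈ) and, after cancelling a common factor t, the
-- next iterate x′ / y′ satisfies F (x , y) = x′ t and a₀ yᵈ = y′ t. Since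
-- a_{d-1} = 0, F (x , y) = a_d xᵈ + y² G (x , y).
--
-- Non-archimedean places: a common divisor of t and y² divides a_d xᵈ, hence
-- v_p t ≤ v_p a_d whenever 2 v_p y > v_p a_d, and then v_p y′ ≥ d v_p y - v_p a_d.
-- For d ≥ 3 this makes 2 v_p y - v_p a_d grow at least d-fold along the orbit,
-- which gives y₀^(2dⁿ) ∣ yₙ² a_d^(dⁿ).
--
-- Archimedean place: once |a_d| x² ≥ d² 𝓗 y², the leading term dominates,
-- |F| ≥ |a_d| |x|ᵈ / 2, and the ratio |a_d| x² / (d² 𝓗 y²) is at least raised to
-- the d-th power at each step (again using d ≥ 3). Combining the two places gives
-- H z ^ (2dⁿ) ≤ H (ψⁿ z)² (d² 𝓗)^(dⁿ) for every n; the gcd condition on the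
-- coefficients is never used.

open import Defs
open import Data.Nat using (ℕ; suc; _+_; _*_; _^_; _≤_)
open import Data.Integer using (ℤ)
open import Data.Rational using (ℚ)
open import Data.Fin using (Fin)
open import Data.Product using (∃-syntax)

open import Data.Nat using (zero; _<_; _∸_; z≤n; s≤s; NonZero; >-nonZero; >-nonZero⁻¹; ≢-nonZero; nonTrivial⇒n>1)
open import Data.Nat.Properties
open import Data.Nat.Divisibility
open import Data.Nat.Primality
open import Data.Nat.Primality.Factorisation using (factorise; PrimeFactorisation)
open import Data.Nat.ListAction using (product)
open import Data.Nat.Induction using (<-rec)
import Data.Nat.Coprimality as Coprime
open import Data.Nat.Tactic.RingSolver using (solve-∀)
open import Algebra.Properties.CommutativeSemigroup *-commutativeSemigroup using (interchange; xy∙z≈xz∙y; x∙yz≈y∙xz; x∙yz≈yx∙z)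
open import Data.Integer as ℤ using (+_; ∣_∣)
import Data.Integer.Properties as ℤ
import Data.Integer.GCD as ℤ
import Data.Integer.Tactic.RingSolver as ℤ
import Data.Integer.Divisibility.Signed as Signed
import Algebra.Properties.CommutativeSemigroup ℤ.*-commutativeSemigroup as ℤ*
open import Data.Rational as ℚ using (mkℚ; ↥_; ↧_; ↧ₙ_)
import Data.Rational.Properties as ℚ
import Data.Rational.Unnormalised as ℚᵘ
open import Data.Fin as Fin using (toℕ; inject₁; fromℕ)
import Data.Fin.Properties as Fin
open import Algebra.Properties.Semiring.Sum ℤ.+-*-semiring using (sum; sum-init-last; sum-cong-≗; *-distribˡ-sum)
open import Data.List.Base using ([]; _∷_)
open import Data.List.Relation.Unary.All using (All; []; _∷_)
open import Data.Product using (_×_; _,_; proj₁; proj₂)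
open import Data.Sum using (inj₁; inj₂)
open import Function.Base using (_∘_; _$_; it)
open import Relation.Nullary using (yes; no; contradiction)
open import Relation.Binary.PropositionalEquality

^-distribʳ-* : ∀ m n k → (m * n) ^ k ≡ m ^ k * n ^ k
^-distribʳ-* m n zero    = refl
^-distribʳ-* m n (suc k) = trans (cong (m * n *_) (^-distribʳ-* m n k)) (interchange m n (m ^ k) (n ^ k))

^-*-comm : ∀ m i j → (m ^ i) ^ j ≡ (m ^ j) ^ i
^-*-comm m i j = trans (^-*-assoc m i j) (trans (cong (m ^_) (*-comm i j)) (sym (^-*-assoc m j i)))

[m*n²]^k : ∀ m n k → (m * n ^ 2) ^ k ≡ m ^ k * (n ^ k) ^ 2
[m*n²]^k m n k = trans (^-distribʳ-* m (n ^ 2) k) (cong (m ^ k *_) (^-*-comm n 2 k))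

^-cancelˡ-≤ : ∀ n .{{_ : NonZero n}} {m o} → m ^ n ≤ o ^ n → m ≤ o
^-cancelˡ-≤ n mⁿ≤oⁿ = ≮⇒≥ (λ o<m → <⇒≱ (^-monoˡ-< n o<m) mⁿ≤oⁿ)

^-monoʳ-∣ : ∀ m {i j} → i ≤ j → m ^ i ∣ m ^ j
^-monoʳ-∣ m {i} {j} i≤j = divides (m ^ (j ∸ i)) (trans (cong (m ^_) (sym (m∸n+n≡m i≤j))) (^-distribˡ-+-* m (j ∸ i) i))

^3+m-bound : ∀ m {a b k} → a ≤ k → b ≤ k → a ^ (3 + m) * k * b ^ 2 ≤ a ^ 3 * k ^ (3 + m)
^3+m-bound m {a} {b} {k} a≤k b≤k = begin
  a ^ (3 + m) * k * b ^ 2        ≡⟨ split a (a ^ m) k b ⟩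
  a ^ 3 * k * (a ^ m * b ^ 2)    ≤⟨ *-monoʳ-≤ (a ^ 3 * k) (*-mono-≤ (^-monoˡ-≤ m a≤k) (^-monoˡ-≤ 2 b≤k)) ⟩
  a ^ 3 * k * (k ^ m * k ^ 2)    ≡⟨ merge a k (k ^ m) ⟩
  a ^ 3 * k ^ (3 + m)            ∎
  where
  open ≤-Reasoning
  split : ∀ a aᵐ k b → a * (a * (a * aᵐ)) * k * (b * (b * 1)) ≡ a * (a * (a * 1)) * k * (aᵐ * (b * (b * 1)))
  split = solve-∀
  merge : ∀ a k kᵐ → a * (a * (a * 1)) * k * (kᵐ * (k * (k * 1))) ≡ a * (a * (a * 1)) * (k * (k * (k * kᵐ)))
  merge = solve-∀

∣i^n∣≡∣i∣^n : ∀ i n → ∣ i ℤ.^ n ∣ ≡ ∣ i ∣ ^ n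
∣i^n∣≡∣i∣^n i zero    = refl
∣i^n∣≡∣i∣^n i (suc n) = trans (ℤ.abs-* i (i ℤ.^ n)) (cong (∣ i ∣ *_) (∣i^n∣≡∣i∣^n i n))

∣sum∣≤ : ∀ n (f : Fin n → ℤ) B → (∀ i → ∣ f i ∣ ≤ B) → ∣ sum f ∣ ≤ n * B
∣sum∣≤ zero    f B _     = z≤n
∣sum∣≤ (suc n) f B ∣f∣≤B = ≤-trans (ℤ.∣i+j∣≤∣i∣+∣j∣ (f Fin.zero) _)
  (+-mono-≤ (∣f∣≤B Fin.zero) (∣sum∣≤ n (f ∘ Fin.suc) B (∣f∣≤B ∘ Fin.suc)))

≤-fraction-trans : ∀ a b c d e f .{{_ : NonZero c}} .{{_ : NonZero d}} →
  a * d ≤ c * b → c * f ≤ e * d → a * f ≤ e * b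
≤-fraction-trans a b c d e f ad≤cb cf≤ed = *-cancelʳ-≤ (a * f) (e * b) (d * c) {{m*n≢0 d c}} (begin
  a * f * (d * c)    ≡⟨ regroup a f d c ⟩
  (a * d) * (c * f)  ≤⟨ *-mono-≤ ad≤cb cf≤ed ⟩
  (c * b) * (e * d)  ≡⟨ regroup′ c b e d ⟩
  e * b * (d * c)    ∎)
  where
  open ≤-Reasoning
  regroup : ∀ a f d c → a * f * (d * c) ≡ (a * d) * (c * f)
  regroup = solve-∀
  regroup′ : ∀ c b e d → (c * b) * (e * d) ≡ e * b * (d * c)
  regroup′ = solve-∀

-- Exact prime powers

infix 4 _^_∥_

record _^_∥_ (p e n : ℕ) : Set where
  constructor exactly
  field
    cofactor   : ℕ
    factorised : n ≡ p ^ e * cofactor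
    p∤cofactor : p ∤ cofactor

module _ {p : ℕ} (p-prime : Prime p) where

  private
    instance
      p≢0 : NonZero p
      p≢0 = prime⇒nonZero p-prime

  1<p : 1 < p
  1<p = nonTrivial⇒n>1 p {{prime⇒nonTrivial p-prime}}

  p∤1 : p ∤ 1
  p∤1 p∣1 = <⇒≢ 1<p (sym (∣1⇒≡1 p∣1))

  ∤⇒^0∥ : ∀ {n} → p ∤ n → p ^ 0 ∥ n
  ∤⇒^0∥ {n} p∤n = exactly n (sym (*-identityˡ n)) p∤n

  ^1∥self : p ^ 1 ∥ p
  ^1∥self = exactly 1 (sym (trans (*-identityʳ (p * 1)) (*-identityʳ p))) p∤1

  ∥⇒^∣ : ∀ {e j n} → p ^ e ∥ n → j ≤ e → p ^ j ∣ n
  ∥⇒^∣ {e} (exactly u refl _) j≤e = ∣-trans (^-monoʳ-∣ p j≤e) (m∣m*n u)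

  ^∣⇒≤ : ∀ {e j n} → p ^ e ∥ n → p ^ j ∣ n → j ≤ e
  ^∣⇒≤ {e} {j} (exactly u refl p∤u) pʲ∣n with j ≤? e
  ... | yes j≤e = j≤e
  ... | no  j≰e = contradiction (*-cancelˡ-∣ (p ^ e) {{m^n≢0 p e}} pᵉp∣pᵉu) p∤u
    where
    pᵉp∣pᵉu : p ^ e * p ∣ p ^ e * u
    pᵉp∣pᵉu = subst (_∣ p ^ e * u) (*-comm p (p ^ e)) (∣-trans (^-monoʳ-∣ p (≰⇒> j≰e)) pʲ∣n)

  ∥-unique : ∀ {e f n} → p ^ e ∥ n → p ^ f ∥ n → e ≡ f
  ∥-unique pᵉ∥n pᶠ∥n = ≤-antisym (^∣⇒≤ pᶠ∥n (∥⇒^∣ pᵉ∥n ≤-refl)) (^∣⇒≤ pᵉ∥n (∥⇒^∣ pᶠ∥n ≤-refl))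

  ∥-* : ∀ {e f m n} → p ^ e ∥ m → p ^ f ∥ n → p ^ (e + f) ∥ m * n
  ∥-* {e} {f} (exactly u refl p∤u) (exactly v refl p∤v) = exactly (u * v) factorisation p∤uv
    where
    factorisation : p ^ e * u * (p ^ f * v) ≡ p ^ (e + f) * (u * v)
    factorisation = trans (interchange (p ^ e) u (p ^ f) v) (cong (_* (u * v)) (sym (^-distribˡ-+-* p e f)))
    p∤uv : p ∤ u * v
    p∤uv p∣uv with euclidsLemma u v p-prime p∣uv
    ... | inj₁ p∣u = p∤u p∣u
    ... | inj₂ p∣v = p∤v p∣v

  ∥-^ : ∀ {e m} → p ^ e ∥ m → ∀ k → p ^ (k * e) ∥ m ^ k
  ∥-^ pᵉ∥m zero    = exactly 1 refl p∤1
  ∥-^ pᵉ∥m (suc k) = ∥-* pᵉ∥m (∥-^ pᵉ∥m k)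

  ∥-exists : ∀ n → .{{NonZero n}} → ∃[ e ] p ^ e ∥ n
  ∥-exists = <-rec (λ n → .{{NonZero n}} → ∃[ e ] p ^ e ∥ n) step
    where
    step : ∀ n → (∀ {m} → m < n → .{{NonZero m}} → ∃[ e ] p ^ e ∥ m) → .{{NonZero n}} → ∃[ e ] p ^ e ∥ n
    step n rec with p ∣? n
    ... | no  p∤n = 0 , ∤⇒^0∥ p∤n
    ... | yes p∣n@(divides q refl) with rec (quotient-< p∣n {{prime⇒nonTrivial p-prime}}) {{quotient≢0 p∣n}}
    ...   | e , exactly u refl p∤u = suc e , exactly u (trans (*-comm (p ^ e * u) p) (sym (*-assoc p (p ^ e) u))) p∤u

∣-from-∥ : ∀ {m n} → .{{NonZero m}} → .{{NonZero n}} →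
  (∀ {p e f} → Prime p → p ^ e ∥ m → p ^ f ∥ n → e ≤ f) → m ∣ n
∣-from-∥ {m} {n} ≤-at = subst (_∣ n) (sym m≡∏) (product∣ (factors fm) (factorsPrime fm) ≤-at∏)
  where
  open PrimeFactorisation
  fm = factorise m
  m≡∏ = isFactorisation fm
  ≤-at∏ : ∀ {p e f} → Prime p → p ^ e ∥ product (factors fm) → p ^ f ∥ n → e ≤ f
  ≤-at∏ p-prime pᵉ∥ = ≤-at p-prime (subst (_ ^ _ ∥_) (sym m≡∏) pᵉ∥)
  product∣ : ∀ qs → All Prime qs → ∀ {n} → .{{NonZero n}} →
    (∀ {p e f} → Prime p → p ^ e ∥ product qs → p ^ f ∥ n → e ≤ f) → product qs ∣ n
  product∣ []       _                    _ = 1∣ _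
  product∣ (q ∷ qs) (q-prime ∷ qs-prime) {n} ≤-at =
    subst (q * product qs ∣_) (trans (*-comm q n′) (sym n≡n′q)) (*-monoʳ-∣ q (product∣ qs qs-prime ≤-at′))
    where
    instance _ = productOfPrimes≢0 qs-prime
    q∣n : q ∣ n
    q∣n with f , qᶠ∥n ← ∥-exists q-prime n =
      subst (_∣ n) (*-identityʳ q) (∥⇒^∣ q-prime qᶠ∥n (≤-trans (s≤s z≤n)
        (≤-at q-prime (∥-* q-prime (^1∥self q-prime) (proj₂ (∥-exists q-prime (product qs)))) qᶠ∥n)))
    n′ = quotient q∣n
    n≡n′q : n ≡ n′ * q
    n≡n′q = _∣_.equality q∣n
    instance _ = m*n≢0⇒m≢0 n′ {{subst NonZero n≡n′q it}}
    ≤-at′ : ∀ {p e f} → Prime p → p ^ e ∥ product qs → p ^ f ∥ n′ → e ≤ f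
    ≤-at′ {e = e} {f} p-prime pᵉ∥ pᶠ∥ with g , pᵍ∥q ← ∥-exists p-prime q {{prime⇒nonZero q-prime}} =
      +-cancelˡ-≤ g _ _ (subst (g + e ≤_) (+-comm f g)
        (≤-at p-prime (∥-* p-prime pᵍ∥q pᵉ∥) (subst (_ ^ _ ∥_) (sym n≡n′q) (∥-* p-prime pᶠ∥ pᵍ∥q))))

-- Unreduced fractions

↥↧-* : ∀ p q → ↥ (p ℚ.* q) ℤ.* (↧ p ℤ.* ↧ q) ≡ (↥ p ℤ.* ↥ q) ℤ.* ↧ (p ℚ.* q)
↥↧-* p@record{} q@record{} with ℚᵘ.*≡* eq ← ℚ.toℚᵘ-homo-* p q =
  trans (cong (ℤ._* (↧ p ℤ.* ↧ q)) (sym (ℚ.↥ᵘ-toℚᵘ (p ℚ.* q))))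
    (trans eq (cong ((↥ p ℤ.* ↥ q) ℤ.*_) (ℚ.↧ᵘ-toℚᵘ (p ℚ.* q))))

↥↧-+ : ∀ p q → ↥ (p ℚ.+ q) ℤ.* (↧ p ℤ.* ↧ q) ≡ (↥ p ℤ.* ↧ q ℤ.+ ↥ q ℤ.* ↧ p) ℤ.* ↧ (p ℚ.+ q)
↥↧-+ p@record{} q@record{} with ℚᵘ.*≡* eq ← ℚ.toℚᵘ-homo-+ p q =
  trans (cong (ℤ._* (↧ p ℤ.* ↧ q)) (sym (ℚ.↥ᵘ-toℚᵘ (p ℚ.+ q))))
    (trans eq (cong ((↥ p ℤ.* ↧ q ℤ.+ ↥ q ℤ.* ↧ p) ℤ.*_) (ℚ.↧ᵘ-toℚᵘ (p ℚ.+ q))))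

infix 4 _≃_/_

-- q ≃ X / n records q · n = X cross-multiplied, so that X / n need not be in
-- lowest terms; for n ≠ 0 it says q = X / n.
record _≃_/_ (q : ℚ) (X : ℤ) (n : ℕ) : Set where
  constructor *≡*
  field
    cross : ↥ q ℤ.* + n ≡ X ℤ.* ↧ q

≃/-* : ∀ {p q X Y m n} → p ≃ X / m → q ≃ Y / n → p ℚ.* q ≃ X ℤ.* Y / m * n
≃/-* {p@record{}} {q@record{}} {X} {Y} {m} {n} (*≡* p≃) (*≡* q≃) = *≡* $ ℤ.*-cancelʳ-≡ _ _ (↧ p ℤ.* ↧ q) (begin
  ↥ (p ℚ.* q) ℤ.* + (m * n) ℤ.* (↧ p ℤ.* ↧ q)     ≡⟨ cong (λ k → ↥ (p ℚ.* q) ℤ.* k ℤ.* (↧ p ℤ.* ↧ q)) (ℤ.pos-* m n) ⟩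
  ↥ (p ℚ.* q) ℤ.* (+ m ℤ.* + n) ℤ.* (↧ p ℤ.* ↧ q)  ≡⟨ ℤ*.xy∙z≈xz∙y (↥ (p ℚ.* q)) (+ m ℤ.* + n) (↧ p ℤ.* ↧ q) ⟩
  ↥ (p ℚ.* q) ℤ.* (↧ p ℤ.* ↧ q) ℤ.* (+ m ℤ.* + n)  ≡⟨ cong (ℤ._* (+ m ℤ.* + n)) (↥↧-* p q) ⟩
  ↥ p ℤ.* ↥ q ℤ.* ↧ (p ℚ.* q) ℤ.* (+ m ℤ.* + n)    ≡⟨ regroup (↥ p) (↥ q) (↧ (p ℚ.* q)) (+ m) (+ n) ⟩
  (↥ p ℤ.* + m) ℤ.* (↥ q ℤ.* + n) ℤ.* ↧ (p ℚ.* q)  ≡⟨ cong₂ (λ u v → u ℤ.* v ℤ.* ↧ (p ℚ.* q)) p≃ q≃ ⟩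
  (X ℤ.* ↧ p) ℤ.* (Y ℤ.* ↧ q) ℤ.* ↧ (p ℚ.* q)      ≡⟨ regroup′ X (↧ p) Y (↧ q) (↧ (p ℚ.* q)) ⟩
  X ℤ.* Y ℤ.* ↧ (p ℚ.* q) ℤ.* (↧ p ℤ.* ↧ q)        ∎)
  where
  open ≡-Reasoning
  regroup : ∀ a b c d e → a ℤ.* b ℤ.* c ℤ.* (d ℤ.* e) ≡ (a ℤ.* d) ℤ.* (b ℤ.* e) ℤ.* c
  regroup = ℤ.solve-∀
  regroup′ : ∀ a b c d e → (a ℤ.* b) ℤ.* (c ℤ.* d) ℤ.* e ≡ a ℤ.* c ℤ.* e ℤ.* (b ℤ.* d)
  regroup′ = ℤ.solve-∀

≃/-+ : ∀ {p q X Y n} → p ≃ X / n → q ≃ Y / n → p ℚ.+ q ≃ X ℤ.+ Y / n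
≃/-+ {p@record{}} {q@record{}} {X} {Y} {n} (*≡* p≃) (*≡* q≃) = *≡* $ ℤ.*-cancelʳ-≡ _ _ (↧ p ℤ.* ↧ q) (begin
  ↥ (p ℚ.+ q) ℤ.* + n ℤ.* (↧ p ℤ.* ↧ q)                             ≡⟨ ℤ*.xy∙z≈xz∙y (↥ (p ℚ.+ q)) (+ n) (↧ p ℤ.* ↧ q) ⟩
  ↥ (p ℚ.+ q) ℤ.* (↧ p ℤ.* ↧ q) ℤ.* + n                             ≡⟨ cong (ℤ._* + n) (↥↧-+ p q) ⟩
  (↥ p ℤ.* ↧ q ℤ.+ ↥ q ℤ.* ↧ p) ℤ.* ↧ (p ℚ.+ q) ℤ.* + n             ≡⟨ spread (↥ p) (↧ q) (↥ q) (↧ p) (↧ (p ℚ.+ q)) (+ n) ⟩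
  ((↥ p ℤ.* + n) ℤ.* ↧ q ℤ.+ (↥ q ℤ.* + n) ℤ.* ↧ p) ℤ.* ↧ (p ℚ.+ q) ≡⟨ cong₂ (λ u v → (u ℤ.* ↧ q ℤ.+ v ℤ.* ↧ p) ℤ.* ↧ (p ℚ.+ q)) p≃ q≃ ⟩
  ((X ℤ.* ↧ p) ℤ.* ↧ q ℤ.+ (Y ℤ.* ↧ q) ℤ.* ↧ p) ℤ.* ↧ (p ℚ.+ q)     ≡⟨ collect X (↧ p) (↧ q) Y (↧ (p ℚ.+ q)) ⟩
  (X ℤ.+ Y) ℤ.* ↧ (p ℚ.+ q) ℤ.* (↧ p ℤ.* ↧ q)                       ∎)
  where
  open ≡-Reasoning
  spread : ∀ a b c d e m → (a ℤ.* b ℤ.+ c ℤ.* d) ℤ.* e ℤ.* m ≡ ((a ℤ.* m) ℤ.* b ℤ.+ (c ℤ.* m) ℤ.* d) ℤ.* e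
  spread = ℤ.solve-∀
  collect : ∀ x a b y e → ((x ℤ.* a) ℤ.* b ℤ.+ (y ℤ.* b) ℤ.* a) ℤ.* e ≡ (x ℤ.+ y) ℤ.* e ℤ.* (a ℤ.* b)
  collect = ℤ.solve-∀

≃/-scale : ∀ {q X n} k → q ≃ X / n → q ≃ X ℤ.* + k / n * k
≃/-scale {q} {X} {n} k (*≡* q≃) = *≡* $ begin
  ↥ q ℤ.* + (n * k)       ≡⟨ cong (↥ q ℤ.*_) (ℤ.pos-* n k) ⟩
  ↥ q ℤ.* (+ n ℤ.* + k)   ≡⟨ ℤ.*-assoc (↥ q) (+ n) (+ k) ⟨
  ↥ q ℤ.* + n ℤ.* + k     ≡⟨ cong (ℤ._* + k) q≃ ⟩
  X ℤ.* ↧ q ℤ.* + k       ≡⟨ ℤ*.xy∙z≈xz∙y X (↧ q) (+ k) ⟩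
  X ℤ.* + k ℤ.* ↧ q       ∎
  where open ≡-Reasoning

≃/-divℤ : ∀ X n → divℤ X (+ suc n) ≃ X / suc n
≃/-divℤ X n = *≡* $ begin
  ↥ r ℤ.* + suc n        ≡⟨ cong (↥ r ℤ.*_) (ℚ.↧-/ X (suc n)) ⟨
  ↥ r ℤ.* (↧ r ℤ.* g)    ≡⟨ ℤ*.x∙yz≈xz∙y (↥ r) (↧ r) g ⟩
  ↥ r ℤ.* g ℤ.* ↧ r      ≡⟨ cong (ℤ._* ↧ r) (ℚ.↥-/ X (suc n)) ⟩
  X ℤ.* ↧ r              ∎
  where
  open ≡-Reasoning
  r = X ℚ./ suc n
  g = ℤ.gcd X (+ suc n)

≃/-↥/↧ : ∀ w → w ≃ ↥ w / ↧ₙ w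
≃/-↥/↧ w = *≡* refl

≃/-powℚ : ∀ {w X n} → w ≃ X / n → ∀ k → powℚ w k ≃ X ℤ.^ k / n ^ k
≃/-powℚ w≃ zero    = *≡* refl
≃/-powℚ w≃ (suc k) = ≃/-* w≃ (≃/-powℚ w≃ k)

≃/-sumFin : ∀ {n} m (f : Fin m → ℚ) (X : Fin m → ℤ) → (∀ i → f i ≃ X i / n) → sumFin m f ≃ sum X / n
≃/-sumFin {n} zero f X _   = *≡* (ℤ.*-zeroˡ (+ n))
≃/-sumFin (suc m) f X f≃X = ≃/-+ (f≃X Fin.zero) (≃/-sumFin m (f ∘ Fin.suc) (X ∘ Fin.suc) (f≃X ∘ Fin.suc))

≃/⇒multiple : ∀ {q X n} .{{_ : NonZero n}} → q ≃ X / n → ∃[ t ] X ≡ ↥ q ℤ.* + t × n ≡ ↧ₙ q * t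
≃/⇒multiple {q@(mkℚ x y-1 x⊥y)} {X} {n@(suc _)} (*≡* q≃) = t , X≡xt , trans n≡ty (*-comm t y)
  where
  y = suc y-1
  y∣∣x∣n : y ∣ ∣ x ∣ * n
  y∣∣x∣n = divides ∣ X ∣ (trans (sym (ℤ.abs-* x (+ n))) (trans (cong ∣_∣ q≃) (ℤ.abs-* X (+ y))))
  y∣n : y ∣ n
  y∣n = Coprime.coprime-divisor (Coprime.sym (Coprime.recompute x⊥y)) y∣∣x∣n
  t = quotient y∣n
  n≡ty : n ≡ t * y
  n≡ty = _∣_.equality y∣n
  X≡xt : X ≡ x ℤ.* + t
  X≡xt = ℤ.*-cancelʳ-≡ X (x ℤ.* + t) (+ y) (sym (begin
    x ℤ.* + t ℤ.* + y     ≡⟨ ℤ.*-assoc x (+ t) (+ y) ⟩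
    x ℤ.* (+ t ℤ.* + y)   ≡⟨ cong (x ℤ.*_) (ℤ.pos-* t y) ⟨
    x ℤ.* + (t * y)       ≡⟨ cong (λ m → x ℤ.* + m) n≡ty ⟨
    x ℤ.* + n             ≡⟨ q≃ ⟩
    X ℤ.* + y             ∎))
    where open ≡-Reasoning

-- The homogenised polynomial

monomial : ℤ → ℤ → ℕ → ℕ → ℕ → ℤ
monomial c x k y j = c ℤ.* x ℤ.^ k ℤ.* + (y ^ j)

homogenise : (d : ℕ) → (Fin (suc d) → ℤ) → ℤ → ℕ → ℤ
homogenise d a x y = sum λ i → monomial (a i) x (toℕ i) y (d ∸ toℕ i)

-- The terms of G in F = y² G + a_d xᵈ; the exponent d ∸ k ∸ 2 is truncated at k = d - 1,
-- which is harmless since a_{d-1} = 0 there.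
homogenise-tail-terms : (d : ℕ) → (Fin (suc d) → ℤ) → ℤ → ℕ → Fin d → ℤ
homogenise-tail-terms d a x y i = monomial (a (inject₁ i)) x (toℕ (inject₁ i)) y (d ∸ toℕ (inject₁ i) ∸ 2)

homogenise-tail : (d : ℕ) → (Fin (suc d) → ℤ) → ℤ → ℕ → ℤ
homogenise-tail d a x y = sum (homogenise-tail-terms d a x y)

ψ-fraction : ∀ d (a : Fin (suc d) → ℤ) A → a Fin.zero ≡ + suc A → ∀ w →
  ψ d a w ≃ homogenise d a (↥ w) (↧ₙ w) / suc A * ↧ₙ w ^ d
ψ-fraction d a A a₀≡ w = ≃/-sumFin (suc d) _ _ term
  where
  y = ↧ₙ w
  term : ∀ i → divℤ (a i) (a Fin.zero) ℚ.* powℚ w (toℕ i) ≃ monomial (a i) (↥ w) (toℕ i) y (d ∸ toℕ i) / suc A * y ^ d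
  term i = subst (divℤ (a i) (a Fin.zero) ℚ.* powℚ w k ≃ monomial (a i) (↥ w) k y (d ∸ k) /_) denominator
    (≃/-scale (y ^ (d ∸ k)) (≃/-* a₀⁻¹aᵢ (≃/-powℚ (≃/-↥/↧ w) k)))
    where
    k = toℕ i
    a₀⁻¹aᵢ : divℤ (a i) (a Fin.zero) ≃ a i / suc A
    a₀⁻¹aᵢ = subst (λ a₀ → divℤ (a i) a₀ ≃ a i / suc A) (sym a₀≡) (≃/-divℤ (a i) A)
    denominator : suc A * y ^ k * y ^ (d ∸ k) ≡ suc A * y ^ d
    denominator = begin
      suc A * y ^ k * y ^ (d ∸ k)    ≡⟨ *-assoc (suc A) (y ^ k) (y ^ (d ∸ k)) ⟩
      suc A * (y ^ k * y ^ (d ∸ k))  ≡⟨ cong (suc A *_) (^-distribˡ-+-* y k (d ∸ k)) ⟨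
      suc A * y ^ (k + (d ∸ k))      ≡⟨ cong (λ e → suc A * y ^ e) (m+[n∸m]≡n (Fin.toℕ≤pred[n] i)) ⟩
      suc A * y ^ d                  ∎
      where open ≡-Reasoning

split-y² : ∀ c x y k j → (j ≡ 1 → c ≡ + 0) → 1 ≤ j → monomial c x k y j ≡ + (y ^ 2) ℤ.* monomial c x k y (j ∸ 2)
split-y² c x y k (suc zero) c≡0 _ rewrite c≡0 refl = sym (ℤ.*-zeroʳ (+ (y ^ 2)))
split-y² c x y k (suc (suc j)) _ _ = begin
  c ℤ.* x ℤ.^ k ℤ.* + (y ^ (2 + j))            ≡⟨ cong (λ n → c ℤ.* x ℤ.^ k ℤ.* + n) (^-distribˡ-+-* y 2 j) ⟩
  c ℤ.* x ℤ.^ k ℤ.* + (y ^ 2 * y ^ j)          ≡⟨ cong (c ℤ.* x ℤ.^ k ℤ.*_) (ℤ.pos-* (y ^ 2) (y ^ j)) ⟩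
  c ℤ.* x ℤ.^ k ℤ.* (+ (y ^ 2) ℤ.* + (y ^ j))  ≡⟨ ℤ*.x∙yz≈y∙xz (c ℤ.* x ℤ.^ k) (+ (y ^ 2)) (+ (y ^ j)) ⟩
  + (y ^ 2) ℤ.* (c ℤ.* x ℤ.^ k ℤ.* + (y ^ j))  ∎
  where open ≡-Reasoning

split-y²-bound : ∀ c x y k j → (j ≡ 1 → c ≡ + 0) → 1 ≤ j → y ≤ ∣ x ∣ →
  ∣ monomial c x k y (j ∸ 2) ∣ ≤ ∣ c ∣ * ∣ x ∣ ^ (k + j ∸ 2)
split-y²-bound c x y k (suc zero) c≡0 _ _ rewrite c≡0 refl = z≤n
split-y²-bound c x y k (suc (suc j)) _ _ y≤∣x∣ = begin
  ∣ c ℤ.* x ℤ.^ k ℤ.* + (y ^ j) ∣      ≡⟨ trans (ℤ.abs-* (c ℤ.* x ℤ.^ k) _) (cong (_* y ^ j) (ℤ.abs-* c (x ℤ.^ k))) ⟩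
  ∣ c ∣ * ∣ x ℤ.^ k ∣ * y ^ j          ≤⟨ *-monoʳ-≤ (∣ c ∣ * ∣ x ℤ.^ k ∣) (^-monoˡ-≤ j y≤∣x∣) ⟩
  ∣ c ∣ * ∣ x ℤ.^ k ∣ * ∣ x ∣ ^ j      ≡⟨ cong (λ n → ∣ c ∣ * n * ∣ x ∣ ^ j) (∣i^n∣≡∣i∣^n x k) ⟩
  ∣ c ∣ * ∣ x ∣ ^ k * ∣ x ∣ ^ j        ≡⟨ *-assoc ∣ c ∣ _ _ ⟩
  ∣ c ∣ * (∣ x ∣ ^ k * ∣ x ∣ ^ j)      ≡⟨ cong (∣ c ∣ *_) (^-distribˡ-+-* ∣ x ∣ k j) ⟨
  ∣ c ∣ * ∣ x ∣ ^ (k + j)              ≡⟨ cong (λ e → ∣ c ∣ * ∣ x ∣ ^ e) (+-∸-assoc k {2 + j} {2} (s≤s (s≤s z≤n))) ⟨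
  ∣ c ∣ * ∣ x ∣ ^ (k + suc (suc j) ∸ 2) ∎
  where open ≤-Reasoning

module _ {d : ℕ} {a : Fin (suc d) → ℤ} (gap : ∀ i → toℕ i ≡ d ∸ 1 → a i ≡ + 0) where

  private
    k≤d : ∀ (i : Fin d) → toℕ (inject₁ i) ≤ d
    k≤d i = subst (_≤ d) (sym (Fin.toℕ-inject₁ i)) (Fin.toℕ≤n i)
    1≤d∸k : ∀ (i : Fin d) → 1 ≤ d ∸ toℕ (inject₁ i)
    1≤d∸k i = m<n⇒0<n∸m (subst (_< d) (sym (Fin.toℕ-inject₁ i)) (Fin.toℕ<n i))
    gap′ : ∀ (i : Fin d) → d ∸ toℕ (inject₁ i) ≡ 1 → a (inject₁ i) ≡ + 0
    gap′ i d∸k≡1 = gap (inject₁ i) (trans (sym (m∸[m∸n]≡n (k≤d i))) (cong (d ∸_) d∸k≡1))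

  homogenise-split : ∀ x y → homogenise d a x y ≡ + (y ^ 2) ℤ.* homogenise-tail d a x y ℤ.+ a (fromℕ d) ℤ.* x ℤ.^ d
  homogenise-split x y = begin
    homogenise d a x y                     ≡⟨ sum-init-last f ⟩
    sum (f ∘ inject₁) ℤ.+ f (fromℕ d)      ≡⟨ cong₂ ℤ._+_ (trans (sum-cong-≗ split) (sym (*-distribˡ-sum (+ (y ^ 2)) G))) top ⟩
    + (y ^ 2) ℤ.* sum G ℤ.+ a (fromℕ d) ℤ.* x ℤ.^ d ∎
    where
    open ≡-Reasoning
    f : Fin (suc d) → ℤ
    f i = monomial (a i) x (toℕ i) y (d ∸ toℕ i)
    G = homogenise-tail-terms d a x y
    split : ∀ i → f (inject₁ i) ≡ + (y ^ 2) ℤ.* G i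
    split i = split-y² (a (inject₁ i)) x y (toℕ (inject₁ i)) (d ∸ toℕ (inject₁ i)) (gap′ i) (1≤d∸k i)
    top : f (fromℕ d) ≡ a (fromℕ d) ℤ.* x ℤ.^ d
    top rewrite Fin.toℕ-fromℕ d | n∸n≡0 d = ℤ.*-identityʳ _

  homogenise-tail-bound : ∀ {H} → (∀ i → ∣ a i ∣ ≤ H) → ∀ x y → y ≤ ∣ x ∣ →
    ∣ homogenise-tail d a x y ∣ ≤ d * (H * ∣ x ∣ ^ (d ∸ 2))
  homogenise-tail-bound {H} ∣a∣≤H x y y≤∣x∣ = ∣sum∣≤ d (homogenise-tail-terms d a x y) _ λ i → begin
    ∣ homogenise-tail-terms d a x y i ∣
      ≤⟨ split-y²-bound (a (inject₁ i)) x y (toℕ (inject₁ i)) (d ∸ toℕ (inject₁ i)) (gap′ i) (1≤d∸k i) y≤∣x∣ ⟩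
    ∣ a (inject₁ i) ∣ * ∣ x ∣ ^ (toℕ (inject₁ i) + (d ∸ toℕ (inject₁ i)) ∸ 2)
      ≡⟨ cong (λ e → ∣ a (inject₁ i) ∣ * ∣ x ∣ ^ (e ∸ 2)) (m+[n∸m]≡n (k≤d i)) ⟩
    ∣ a (inject₁ i) ∣ * ∣ x ∣ ^ (d ∸ 2)
      ≤⟨ *-monoˡ-≤ _ (∣a∣≤H (inject₁ i)) ⟩
    H * ∣ x ∣ ^ (d ∸ 2) ∎
    where open ≤-Reasoning

  leading-term-dominates : 2 ≤ d → ∀ {H} → (∀ i → ∣ a i ∣ ≤ H) → ∀ x y → y ≤ ∣ x ∣ →
    H * (d * d) * y ^ 2 ≤ ∣ a (fromℕ d) ∣ * ∣ x ∣ ^ 2 →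
    ∣ a (fromℕ d) ∣ * ∣ x ∣ ^ d ≤ 2 * ∣ homogenise d a x y ∣
  leading-term-dominates 2≤d {H} ∣a∣≤H x y y≤∣x∣ Hd²y²≤αx² = +-cancelˡ-≤ u _ _ (begin
    u + u                  ≡⟨ cong (_+_ u) (+-identityʳ u) ⟨
    2 * u                  ≤⟨ *-monoʳ-≤ 2 u≤F+s ⟩
    2 * (∣ F ∣ + s)        ≡⟨ *-distribˡ-+ 2 ∣ F ∣ s ⟩
    2 * ∣ F ∣ + 2 * s      ≤⟨ +-monoʳ-≤ (2 * ∣ F ∣) (≤-trans (*-monoˡ-≤ s 2≤d) ds≤u) ⟩
    2 * ∣ F ∣ + u          ≡⟨ +-comm (2 * ∣ F ∣) u ⟩
    u + 2 * ∣ F ∣          ∎)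
    where
    open ≤-Reasoning
    X = ∣ x ∣
    α = ∣ a (fromℕ d) ∣
    F = homogenise d a x y
    G = homogenise-tail d a x y
    u = α * X ^ d
    s = ∣ + (y ^ 2) ℤ.* G ∣
    u≤F+s : u ≤ ∣ F ∣ + s
    u≤F+s = begin
      u                                  ≡⟨ trans (ℤ.abs-* (a (fromℕ d)) (x ℤ.^ d)) (cong (α *_) (∣i^n∣≡∣i∣^n x d)) ⟨
      ∣ a (fromℕ d) ℤ.* x ℤ.^ d ∣        ≡⟨ cong ∣_∣ (trans (isolate (+ (y ^ 2) ℤ.* G) _) (cong (ℤ._- (+ (y ^ 2) ℤ.* G)) (sym (homogenise-split x y)))) ⟩
      ∣ F ℤ.- + (y ^ 2) ℤ.* G ∣          ≤⟨ ℤ.∣i+j∣≤∣i∣+∣j∣ F _ ⟩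
      ∣ F ∣ + ∣ ℤ.- (+ (y ^ 2) ℤ.* G) ∣  ≡⟨ cong (_+_ ∣ F ∣) (ℤ.∣-i∣≡∣i∣ (+ (y ^ 2) ℤ.* G)) ⟩
      ∣ F ∣ + s                          ∎
      where
      isolate : ∀ p q → q ≡ p ℤ.+ q ℤ.- p
      isolate = ℤ.solve-∀
    ds≤u : d * s ≤ u
    ds≤u = begin
      d * s                                      ≡⟨ cong (d *_) (ℤ.abs-* (+ (y ^ 2)) G) ⟩
      d * (y ^ 2 * ∣ G ∣)                        ≤⟨ *-monoʳ-≤ d (*-monoʳ-≤ (y ^ 2) (homogenise-tail-bound ∣a∣≤H x y y≤∣x∣)) ⟩
      d * (y ^ 2 * (d * (H * X ^ (d ∸ 2))))      ≡⟨ regroup d (y ^ 2) H (X ^ (d ∸ 2)) ⟩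
      H * (d * d) * y ^ 2 * X ^ (d ∸ 2)          ≤⟨ *-monoˡ-≤ (X ^ (d ∸ 2)) Hd²y²≤αx² ⟩
      α * X ^ 2 * X ^ (d ∸ 2)                    ≡⟨ *-assoc α (X ^ 2) _ ⟩
      α * (X ^ 2 * X ^ (d ∸ 2))                  ≡⟨ cong (α *_) (^-distribˡ-+-* X 2 (d ∸ 2)) ⟨
      α * X ^ (2 + (d ∸ 2))                      ≡⟨ cong (λ e → α * X ^ e) (m+[n∸m]≡n 2≤d) ⟩
      u                                          ∎
      where
      regroup : ∀ d y h z → d * (y * (d * (h * z))) ≡ h * (d * d) * y * z
      regroup = solve-∀

  ∣homogenise⇒∣leading-term : ∀ {q} x y → q ∣ ∣ homogenise d a x y ∣ → q ∣ y ^ 2 → q ∣ ∣ a (fromℕ d) ∣ * ∣ x ∣ ^ d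
  ∣homogenise⇒∣leading-term {q} x y q∣F q∣y² =
    subst (q ∣_) (trans (ℤ.abs-* (a (fromℕ d)) (x ℤ.^ d)) (cong (∣ a (fromℕ d) ∣ *_) (∣i^n∣≡∣i∣^n x d)))
      (Signed.∣⇒∣ᵤ {+ q} {a (fromℕ d) ℤ.* x ℤ.^ d}
        (Signed.∣m+n∣m⇒∣n (subst (+ q Signed.∣_) (homogenise-split x y) (Signed.∣ᵤ⇒∣ q∣F))
                          (Signed.∣m⇒∣m*n {+ q} {+ (y ^ 2)} (homogenise-tail d a x y) (Signed.∣ᵤ⇒∣ q∣y²))))

-- Iterating a growth of ratios

module _ {A : Set} (f : A → A) (P Q : A → ℕ) (Q≢0 : ∀ w → NonZero (Q w)) (d : ℕ)
         (ratio-grows : ∀ w → Q w ≤ P w → P w ^ d * Q (f w) ≤ P (f w) * Q w ^ d) where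

  ratio-grows-preserves-≤ : ∀ w → Q w ≤ P w → Q (f w) ≤ P (f w)
  ratio-grows-preserves-≤ w Qw≤Pw = *-cancelˡ-≤ (Q w ^ d) {{m^n≢0 (Q w) d {{Q≢0 w}}}} (begin
    Q w ^ d * Q (f w)   ≤⟨ *-monoˡ-≤ (Q (f w)) (^-monoˡ-≤ d Qw≤Pw) ⟩
    P w ^ d * Q (f w)   ≤⟨ ratio-grows w Qw≤Pw ⟩
    P (f w) * Q w ^ d   ≡⟨ *-comm (P (f w)) (Q w ^ d) ⟩
    Q w ^ d * P (f w)   ∎)
    where open ≤-Reasoning

  iter-preserves-≤ : ∀ z → Q z ≤ P z → ∀ n → Q (iter f n z) ≤ P (iter f n z)
  iter-preserves-≤ z Qz≤Pz zero    = Qz≤Pz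
  iter-preserves-≤ z Qz≤Pz (suc n) = ratio-grows-preserves-≤ (iter f n z) (iter-preserves-≤ z Qz≤Pz n)

  iter-ratio-grows : ∀ z → Q z ≤ P z → ∀ n → P z ^ d ^ n * Q (iter f n z) ≤ P (iter f n z) * Q z ^ d ^ n
  iter-ratio-grows z Qz≤Pz zero =
    ≤-reflexive (trans (cong (_* Q z) (*-identityʳ (P z))) (cong (P z *_) (sym (*-identityʳ (Q z)))))
  iter-ratio-grows z Qz≤Pz (suc n) =
    ≤-fraction-trans (P z ^ d ^ suc n) (Q z ^ d ^ suc n) (P w ^ d) (Q w ^ d) (P (f w)) (Q (f w))
      {{m^n≢0 (P w) d {{>-nonZero (<-≤-trans (>-nonZero⁻¹ (Q w) {{Q≢0 w}}) Qw≤Pw)}}}} {{m^n≢0 (Q w) d {{Q≢0 w}}}}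
      ih^d (ratio-grows w Qw≤Pw)
    where
    w = iter f n z
    Qw≤Pw = iter-preserves-≤ z Qz≤Pz n
    ih^d : P z ^ d ^ suc n * Q w ^ d ≤ P w ^ d * Q z ^ d ^ suc n
    ih^d = begin
      P z ^ (d * d ^ n) * Q w ^ d        ≡⟨ cong (_* Q w ^ d) (^d*k≡[^k]^d (P z) (d ^ n)) ⟩
      (P z ^ d ^ n) ^ d * Q w ^ d        ≡⟨ ^-distribʳ-* (P z ^ d ^ n) (Q w) d ⟨
      (P z ^ d ^ n * Q w) ^ d            ≤⟨ ^-monoˡ-≤ d (iter-ratio-grows z Qz≤Pz n) ⟩
      (P w * Q z ^ d ^ n) ^ d            ≡⟨ ^-distribʳ-* (P w) (Q z ^ d ^ n) d ⟩
      P w ^ d * (Q z ^ d ^ n) ^ d        ≡⟨ cong (P w ^ d *_) (^d*k≡[^k]^d (Q z) (d ^ n)) ⟨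
      P w ^ d * Q z ^ (d * d ^ n)        ∎
      where
      open ≤-Reasoning
      ^d*k≡[^k]^d : ∀ m k → m ^ (d * k) ≡ (m ^ k) ^ d
      ^d*k≡[^k]^d m k = trans (cong (m ^_) (*-comm d k)) (sym (^-*-assoc m k d))

-- The height bound along an orbit

maxFin-upper : ∀ n (f : Fin n → ℕ) i → f i ≤ maxFin n f
maxFin-upper (suc n) f Fin.zero    = m≤m⊔n (f Fin.zero) _
maxFin-upper (suc n) f (Fin.suc i) = ≤-trans (maxFin-upper n (f ∘ Fin.suc) i) (m≤n⊔m (f Fin.zero) _)

positive⇒suc : ∀ {z} → ℤ.+0 ℤ.< z → ∃[ n ] z ≡ + suc n
positive⇒suc {+ suc n} _         = n , refl
positive⇒suc {+ zero}  (ℤ.+<+ ())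

module HeightBound {d : ℕ} (3≤d : 3 ≤ d) {a : Fin (suc d) → ℤ} (adm : Admissible d a) where
  open Admissible adm

  α H K : ℕ
  α = ∣ a (fromℕ d) ∣
  H = Hψ d a
  K = H * (d * d)

  X Y : ℚ → ℕ
  X w = ∣ ↥ w ∣
  Y w = ↧ₙ w

  A₀ : ℕ
  A₀ = suc (proj₁ (positive⇒suc a₀-pos))

  a₀≡A₀ : a Fin.zero ≡ + A₀
  a₀≡A₀ = proj₂ (positive⇒suc a₀-pos)

  private
    2≤d : 2 ≤ d
    2≤d = ≤-trans (s≤s (s≤s z≤n)) 3≤d
    instance
      d≢0 : NonZero d
      d≢0 = >-nonZero (≤-trans (s≤s z≤n) 3≤d)

  ∣a∣≤H : ∀ i → ∣ a i ∣ ≤ H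
  ∣a∣≤H = maxFin-upper (suc d) (λ i → ∣ a i ∣)

  A₀≤H : A₀ ≤ H
  A₀≤H = subst (_≤ H) (cong ∣_∣ a₀≡A₀) (∣a∣≤H Fin.zero)

  instance
    α≢0 : NonZero α
    α≢0 = ≢-nonZero (λ α≡0 → lead (ℤ.∣i∣≡0⇒i≡0 α≡0))
    K≢0 : NonZero K
    K≢0 = m*n≢0 H (d * d) {{>-nonZero (≤-trans (s≤s z≤n) A₀≤H)}} {{m*n≢0 d d}}

  α≤K : α ≤ K
  α≤K = ≤-trans (∣a∣≤H (fromℕ d)) (m≤m*n H (d * d) {{m*n≢0 d d}})

  2A₀≤K : 2 * A₀ ≤ K
  2A₀≤K = begin
    2 * A₀       ≤⟨ *-monoʳ-≤ 2 A₀≤H ⟩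
    2 * H        ≤⟨ *-monoˡ-≤ H (≤-trans 2≤d (m≤m*n d d)) ⟩
    d * d * H    ≡⟨ *-comm (d * d) H ⟩
    K            ∎
    where open ≤-Reasoning

  αᵈK[2A₀]²≤α³Kᵈ : α ^ d * K * (2 * A₀) ^ 2 ≤ α ^ 3 * K ^ d
  αᵈK[2A₀]²≤α³Kᵈ = subst (λ e → α ^ e * K * (2 * A₀) ^ 2 ≤ α ^ 3 * K ^ e) (m+[n∸m]≡n 3≤d) (^3+m-bound (d ∸ 3) α≤K 2A₀≤K)

  ψ-in-lowest-terms : ∀ w → ∃[ t ] homogenise d a (↥ w) (Y w) ≡ ↥ (ψ d a w) ℤ.* + t × A₀ * Y w ^ d ≡ Y (ψ d a w) * t
  ψ-in-lowest-terms w = ≃/⇒multiple {{m*n≢0 A₀ (Y w ^ d) {{_}} {{m^n≢0 (Y w) d}}}} (ψ-fraction d a _ a₀≡A₀ w)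

  -- Q w ≤ P w is the region |a_d| x² ≥ d² 𝓗 y² in which the leading term of F dominates.
  P Q : ℚ → ℕ
  P w = α * X w ^ 2
  Q w = K * Y w ^ 2

  Q≢0 : ∀ w → NonZero (Q w)
  Q≢0 w = m*n≢0 K (Y w ^ 2) {{K≢0}} {{m^n≢0 (Y w) 2}}

  Q≤P⇒Y≤X : ∀ w → Q w ≤ P w → Y w ≤ X w
  Q≤P⇒Y≤X w Qw≤Pw = ^-cancelˡ-≤ 2 (*-cancelˡ-≤ K (≤-trans Qw≤Pw (*-monoˡ-≤ (X w ^ 2) α≤K)))

  αXᵈY′≤2A₀X′Yᵈ : ∀ w → Q w ≤ P w → α * X w ^ d * Y (ψ d a w) ≤ 2 * A₀ * X (ψ d a w) * Y w ^ d
  αXᵈY′≤2A₀X′Yᵈ w Qw≤Pw with t , F≡x′t , A₀yᵈ≡y′t ← ψ-in-lowest-terms w = begin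
    α * X w ^ d * Y′                         ≤⟨ *-monoˡ-≤ Y′ (leading-term-dominates gap 2≤d ∣a∣≤H (↥ w) (Y w) (Q≤P⇒Y≤X w Qw≤Pw) Qw≤Pw) ⟩
    2 * ∣ homogenise d a (↥ w) (Y w) ∣ * Y′  ≡⟨ cong (λ n → 2 * n * Y′) (trans (cong ∣_∣ F≡x′t) (ℤ.abs-* (↥ ψ d a w) (+ t))) ⟩
    2 * (X′ * t) * Y′                        ≡⟨ regroup X′ t Y′ ⟩
    2 * X′ * (Y′ * t)                        ≡⟨ cong (2 * X′ *_) A₀yᵈ≡y′t ⟨
    2 * X′ * (A₀ * Y w ^ d)                  ≡⟨ regroup′ X′ A₀ (Y w ^ d) ⟩
    2 * A₀ * X′ * Y w ^ d                    ∎
    where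
    open ≤-Reasoning
    X′ = X (ψ d a w)
    Y′ = Y (ψ d a w)
    regroup : ∀ x t y → 2 * (x * t) * y ≡ 2 * x * (y * t)
    regroup = solve-∀
    regroup′ : ∀ x a z → 2 * x * (a * z) ≡ 2 * a * x * z
    regroup′ = solve-∀

  ratio-grows : ∀ w → Q w ≤ P w → P w ^ d * Q (ψ d a w) ≤ P (ψ d a w) * Q w ^ d
  ratio-grows w Qw≤Pw = *-cancelˡ-≤ (α ^ 2) {{m^n≢0 α 2}} (begin
    α ^ 2 * (P w ^ d * Q w′)                               ≡⟨ cong (λ p → α ^ 2 * (p * Q w′)) ([m*n²]^k α (X w) d) ⟩
    α ^ 2 * (α ^ d * (X w ^ d) ^ 2 * Q w′)                 ≡⟨ regroup α (α ^ d) (X w ^ d) K (Y w′) ⟩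
    α ^ d * K * (α * X w ^ d * Y w′) ^ 2                   ≤⟨ *-monoʳ-≤ (α ^ d * K) (^-monoˡ-≤ 2 (αXᵈY′≤2A₀X′Yᵈ w Qw≤Pw)) ⟩
    α ^ d * K * (2 * A₀ * X w′ * Y w ^ d) ^ 2              ≡⟨ regroup′ (α ^ d * K) (2 * A₀) (X w′) (Y w ^ d) ⟩
    α ^ d * K * (2 * A₀) ^ 2 * (X w′ ^ 2 * (Y w ^ d) ^ 2)  ≤⟨ *-monoˡ-≤ (X w′ ^ 2 * (Y w ^ d) ^ 2) αᵈK[2A₀]²≤α³Kᵈ ⟩
    α ^ 3 * K ^ d * (X w′ ^ 2 * (Y w ^ d) ^ 2)             ≡⟨ regroup″ α (K ^ d) (X w′) (Y w ^ d) ⟩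
    α ^ 2 * (P w′ * (K ^ d * (Y w ^ d) ^ 2))               ≡⟨ cong (λ q → α ^ 2 * (P w′ * q)) ([m*n²]^k K (Y w) d) ⟨
    α ^ 2 * (P w′ * Q w ^ d)                               ∎)
    where
    open ≤-Reasoning
    w′ = ψ d a w
    regroup : ∀ a aᵈ xᵈ k y → a * (a * 1) * (aᵈ * (xᵈ * (xᵈ * 1)) * (k * (y * (y * 1))))
                            ≡ aᵈ * k * ((a * xᵈ * y) * ((a * xᵈ * y) * 1))
    regroup = solve-∀
    regroup′ : ∀ c b x yᵈ → c * ((b * x * yᵈ) * ((b * x * yᵈ) * 1)) ≡ c * (b * (b * 1)) * (x * (x * 1) * (yᵈ * (yᵈ * 1)))
    regroup′ = solve-∀
    regroup″ : ∀ a kᵈ x yᵈ → a * (a * (a * 1)) * kᵈ * (x * (x * 1) * (yᵈ * (yᵈ * 1)))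
                           ≡ a * (a * 1) * (a * (x * (x * 1)) * (kᵈ * (yᵈ * (yᵈ * 1))))
    regroup″ = solve-∀

  module _ {p : ℕ} (p-prime : Prime p) where

    ∣Y⇒∤X : ∀ w → p ∣ Y w → p ∤ X w
    ∣Y⇒∤X (mkℚ _ _ x⊥y) p∣Y p∣X = <⇒≢ (1<p p-prime) (sym (Coprime.recompute x⊥y (p∣X , p∣Y)))

    padic-step : ∀ w {c e e′} → p ^ c ∥ α → p ^ e ∥ Y w → p ^ e′ ∥ Y (ψ d a w) → c < 2 * e → d * e ≤ e′ + c
    padic-step w {c} {e} {e′} pᶜ∥α pᵉ∥Y pᵉ′∥Y′ c<2e with t , F≡x′t , A₀yᵈ≡y′t ← ψ-in-lowest-terms w = begin
      d * e        ≤⟨ m≤n+m (d * e) ν ⟩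
      ν + d * e    ≡⟨ ∥-unique p-prime (∥-* p-prime pᵛ∥A₀ (∥-^ p-prime pᵉ∥Y d))
                                       (subst (p ^ e′ + τ ∥_) (sym A₀yᵈ≡y′t) (∥-* p-prime pᵉ′∥Y′ pᵗ∥t)) ⟩
      e′ + τ       ≤⟨ +-monoʳ-≤ e′ τ≤c ⟩
      e′ + c       ∎
      where
      open ≤-Reasoning
      instance
        t≢0 : NonZero t
        t≢0 = m*n≢0⇒n≢0 (Y (ψ d a w)) {{subst NonZero A₀yᵈ≡y′t (m*n≢0 A₀ (Y w ^ d) {{_}} {{m^n≢0 (Y w) d}})}}
      ν = proj₁ (∥-exists p-prime A₀)
      pᵛ∥A₀ = proj₂ (∥-exists p-prime A₀)
      τ = proj₁ (∥-exists p-prime t)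
      pᵗ∥t = proj₂ (∥-exists p-prime t)
      p∤X : p ∤ X w
      p∤X = ∣Y⇒∤X w (subst (_∣ Y w) (*-identityʳ p) (∥⇒^∣ p-prime pᵉ∥Y (n≢0⇒n>0 λ { refl → <⇒≱ c<2e z≤n })))
      pᶜ∥αXᵈ : p ^ (c + d * 0) ∥ α * X w ^ d
      pᶜ∥αXᵈ = ∥-* p-prime pᶜ∥α (∥-^ p-prime (∤⇒^0∥ p-prime p∤X) d)
      τ≤c : τ ≤ c
      τ≤c = ≮⇒≥ λ c<τ → <-irrefl (sym (trans (cong (_+_ c) (*-zeroʳ d)) (+-identityʳ c))) (^∣⇒≤ p-prime pᶜ∥αXᵈ
              (∣homogenise⇒∣leading-term gap (↥ w) (Y w)
                (subst (_ ∣_) (sym (trans (cong ∣_∣ F≡x′t) (ℤ.abs-* (↥ ψ d a w) (+ t))))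
                       (∣-trans (∥⇒^∣ p-prime pᵗ∥t c<τ) (n∣m*n (X (ψ d a w)))))
                (∥⇒^∣ p-prime (∥-^ p-prime pᵉ∥Y 2) c<2e)))

    -- 2 e ∸ c is the valuation of y² / gcd (y² , a_d); the truncation makes the case 2 e ≤ c trivial.
    padic-growth : ∀ w {c e e′} → p ^ c ∥ α → p ^ e ∥ Y w → p ^ e′ ∥ Y (ψ d a w) → d * (2 * e ∸ c) ≤ 2 * e′ ∸ c
    padic-growth w {c} {e} {e′} pᶜ∥α pᵉ∥Y pᵉ′∥Y′ with 2 * e ≤? c
    ... | yes 2e≤c = ≤-trans (≤-reflexive (trans (cong (d *_) (m≤n⇒m∸n≡0 2e≤c)) (*-zeroʳ d))) z≤n
    ... | no  2e≰c = begin
      d * (2 * e ∸ c)          ≡⟨ *-distribˡ-∸ d (2 * e) c ⟩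
      d * (2 * e) ∸ d * c      ≡⟨ cong (_∸ d * c) (x∙yz≈y∙xz d 2 e) ⟩
      2 * (d * e) ∸ d * c      ≤⟨ ∸-monoˡ-≤ (d * c) (*-monoʳ-≤ 2 (padic-step w pᶜ∥α pᵉ∥Y pᵉ′∥Y′ (≰⇒> 2e≰c))) ⟩
      2 * (e′ + c) ∸ d * c     ≤⟨ ∸-monoʳ-≤ (2 * (e′ + c)) (*-monoˡ-≤ c 3≤d) ⟩
      2 * (e′ + c) ∸ 3 * c     ≡⟨ cong₂ _∸_ (expand e′ c) (expand′ c) ⟩
      2 * c + 2 * e′ ∸ (2 * c + c) ≡⟨ [m+n]∸[m+o]≡n∸o (2 * c) (2 * e′) c ⟩
      2 * e′ ∸ c               ∎
      where
      open ≤-Reasoning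
      expand : ∀ e′ c → 2 * (e′ + c) ≡ 2 * c + 2 * e′
      expand = solve-∀
      expand′ : ∀ c → 3 * c ≡ 2 * c + c
      expand′ = solve-∀

    padic-iter : ∀ {c} → p ^ c ∥ α → ∀ z n {e e′} → p ^ e ∥ Y z → p ^ e′ ∥ Y (iter (ψ d a) n z) →
      d ^ n * (2 * e ∸ c) ≤ 2 * e′ ∸ c
    padic-iter {c} pᶜ∥α z zero pᵉ∥Y pᵉ′∥Y =
      ≤-reflexive (trans (+-identityʳ _) (cong (λ f → 2 * f ∸ c) (∥-unique p-prime pᵉ∥Y pᵉ′∥Y)))
    padic-iter {c} pᶜ∥α z (suc n) {e} {e′} pᵉ∥Y pᵉ′∥Y′ = begin
      d * d ^ n * (2 * e ∸ c)      ≡⟨ *-assoc d (d ^ n) _ ⟩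
      d * (d ^ n * (2 * e ∸ c))    ≤⟨ *-monoʳ-≤ d (padic-iter pᶜ∥α z n pᵉ∥Y pᵉⁿ∥Yₙ) ⟩
      d * (2 * eₙ ∸ c)             ≤⟨ padic-growth (iter (ψ d a) n z) pᶜ∥α pᵉⁿ∥Yₙ pᵉ′∥Y′ ⟩
      2 * e′ ∸ c                   ∎
      where
      open ≤-Reasoning
      eₙ = proj₁ (∥-exists p-prime (Y (iter (ψ d a) n z)))
      pᵉⁿ∥Yₙ = proj₂ (∥-exists p-prime (Y (iter (ψ d a) n z)))

  denominator-bound : ∀ z n → (Y z ^ d ^ n) ^ 2 ≤ Y (iter (ψ d a) n z) ^ 2 * α ^ d ^ n
  denominator-bound z n = ∣⇒≤ {{Yₙ²αᴹ≢0}} (∣-from-∥ {{m^n≢0 (Y z ^ M) 2 {{m^n≢0 (Y z) M}}}} {{Yₙ²αᴹ≢0}} valuation-≤)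
    where
    M = d ^ n
    zₙ = iter (ψ d a) n z
    Yₙ²αᴹ≢0 : NonZero (Y zₙ ^ 2 * α ^ M)
    Yₙ²αᴹ≢0 = m*n≢0 (Y zₙ ^ 2) (α ^ M) {{m^n≢0 (Y zₙ) 2}} {{m^n≢0 α M}}
    valuation-≤ : ∀ {p e f} → Prime p → p ^ e ∥ (Y z ^ M) ^ 2 → p ^ f ∥ Y zₙ ^ 2 * α ^ M → e ≤ f
    valuation-≤ p-prime pᵉ∥ pᶠ∥ = subst₂ _≤_ (∥-unique p-prime (∥-^ p-prime (∥-^ p-prime pᵉ⁰∥Y₀ M) 2) pᵉ∥)
      (∥-unique p-prime (∥-* p-prime (∥-^ p-prime pᵉⁿ∥Yₙ 2) (∥-^ p-prime pᶜ∥α M)) pᶠ∥) (begin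
        2 * (M * e₀)                   ≡⟨ x∙yz≈y∙xz 2 M e₀ ⟩
        M * (2 * e₀)                   ≤⟨ *-monoʳ-≤ M (m≤n+m∸n (2 * e₀) c) ⟩
        M * (c + (2 * e₀ ∸ c))         ≡⟨ *-distribˡ-+ M c _ ⟩
        M * c + M * (2 * e₀ ∸ c)       ≤⟨ +-monoʳ-≤ (M * c) (padic-iter p-prime pᶜ∥α z n pᵉ⁰∥Y₀ pᵉⁿ∥Yₙ) ⟩
        M * c + (2 * eₙ ∸ c)           ≤⟨ +-monoʳ-≤ (M * c) (m∸n≤m (2 * eₙ) c) ⟩
        M * c + 2 * eₙ                 ≡⟨ +-comm (M * c) (2 * eₙ) ⟩
        2 * eₙ + M * c                 ∎)
      where
      open ≤-Reasoning
      e₀ = proj₁ (∥-exists p-prime (Y z))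
      pᵉ⁰∥Y₀ = proj₂ (∥-exists p-prime (Y z))
      eₙ = proj₁ (∥-exists p-prime (Y zₙ))
      pᵉⁿ∥Yₙ = proj₂ (∥-exists p-prime (Y zₙ))
      c = proj₁ (∥-exists p-prime α)
      pᶜ∥α = proj₂ (∥-exists p-prime α)

  escaping-height-bound : ∀ z n → Q z ≤ P z → (Hℚ z ^ d ^ n) ^ 2 ≤ Hℚ (iter (ψ d a) n z) ^ 2 * K ^ d ^ n
  escaping-height-bound z n Qz≤Pz = *-cancelʳ-≤ _ _ W {{W≢0}} (begin
    (Hℚ z ^ M) ^ 2 * W                            ≡⟨ cong (λ h → (h ^ M) ^ 2 * W) (m≥n⇒m⊔n≡m (Q≤P⇒Y≤X z Qz≤Pz)) ⟩
    (X z ^ M) ^ 2 * W                             ≡⟨ regroup (α ^ M) (X z ^ M) K (Y zₙ) ⟩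
    α ^ M * (X z ^ M) ^ 2 * Q zₙ                  ≡⟨ cong (_* Q zₙ) ([m*n²]^k α (X z) M) ⟨
    P z ^ M * Q zₙ                                ≤⟨ iter-ratio-grows (ψ d a) P Q Q≢0 d ratio-grows z Qz≤Pz n ⟩
    P zₙ * Q z ^ M                                ≡⟨ cong (P zₙ *_) ([m*n²]^k K (Y z) M) ⟩
    P zₙ * (K ^ M * (Y z ^ M) ^ 2)                ≤⟨ *-monoʳ-≤ (P zₙ) (*-monoʳ-≤ (K ^ M) (denominator-bound z n)) ⟩
    α * X zₙ ^ 2 * (K ^ M * (Y zₙ ^ 2 * α ^ M))   ≤⟨ *-monoˡ-≤ _ (*-mono-≤ α≤K (^-monoˡ-≤ 2 (m≤m⊔n (X zₙ) (Y zₙ)))) ⟩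
    K * Hℚ zₙ ^ 2 * (K ^ M * (Y zₙ ^ 2 * α ^ M))  ≡⟨ regroup′ K (Hℚ zₙ) (K ^ M) (Y zₙ) (α ^ M) ⟩
    Hℚ zₙ ^ 2 * K ^ M * W                         ∎)
    where
    open ≤-Reasoning
    M = d ^ n
    zₙ = iter (ψ d a) n z
    W = α ^ M * Y zₙ ^ 2 * K
    W≢0 : NonZero W
    W≢0 = m*n≢0 (α ^ M * Y zₙ ^ 2) K {{m*n≢0 (α ^ M) (Y zₙ ^ 2) {{m^n≢0 α M}} {{m^n≢0 (Y zₙ) 2}}}}
    regroup : ∀ aᴹ xᴹ k y → xᴹ * (xᴹ * 1) * (aᴹ * (y * (y * 1)) * k) ≡ aᴹ * (xᴹ * (xᴹ * 1)) * (k * (y * (y * 1)))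
    regroup = solve-∀
    regroup′ : ∀ k h kᴹ y aᴹ → k * (h * (h * 1)) * (kᴹ * (y * (y * 1) * aᴹ)) ≡ h * (h * 1) * kᴹ * (aᴹ * (y * (y * 1)) * k)
    regroup′ = solve-∀

  bounded-height-bound : ∀ z n → P z < Q z → (Hℚ z ^ d ^ n) ^ 2 ≤ Hℚ (iter (ψ d a) n z) ^ 2 * K ^ d ^ n
  bounded-height-bound z n Pz<Qz = *-cancelʳ-≤ _ _ (α ^ M) {{m^n≢0 α M}} (begin
    (Hℚ z ^ M) ^ 2 * α ^ M         ≡⟨ *-comm _ (α ^ M) ⟩
    α ^ M * (Hℚ z ^ M) ^ 2         ≡⟨ [m*n²]^k α (Hℚ z) M ⟨
    (α * Hℚ z ^ 2) ^ M             ≤⟨ ^-monoˡ-≤ M αH₀²≤KY₀² ⟩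
    (K * Y z ^ 2) ^ M              ≡⟨ [m*n²]^k K (Y z) M ⟩
    K ^ M * (Y z ^ M) ^ 2          ≤⟨ *-monoʳ-≤ (K ^ M) (denominator-bound z n) ⟩
    K ^ M * (Y zₙ ^ 2 * α ^ M)     ≤⟨ *-monoʳ-≤ (K ^ M) (*-monoˡ-≤ (α ^ M) (^-monoˡ-≤ 2 (m≤n⊔m (X zₙ) (Y zₙ)))) ⟩
    K ^ M * (Hℚ zₙ ^ 2 * α ^ M)    ≡⟨ x∙yz≈yx∙z (K ^ M) (Hℚ zₙ ^ 2) (α ^ M) ⟩
    Hℚ zₙ ^ 2 * K ^ M * α ^ M      ∎)
    where
    open ≤-Reasoning
    M = d ^ n
    zₙ = iter (ψ d a) n z
    αH₀²≤KY₀² : α * Hℚ z ^ 2 ≤ K * Y z ^ 2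
    αH₀²≤KY₀² with ⊔-sel (X z) (Y z)
    ... | inj₁ H≡X = subst (λ h → α * h ^ 2 ≤ K * Y z ^ 2) (sym H≡X) (<⇒≤ Pz<Qz)
    ... | inj₂ H≡Y = subst (λ h → α * h ^ 2 ≤ K * Y z ^ 2) (sym H≡Y) (*-monoˡ-≤ (Y z ^ 2) α≤K)

  height-bound : ∀ z n → (Hℚ z ^ d ^ n) ^ 2 ≤ Hℚ (iter (ψ d a) n z) ^ 2 * K ^ d ^ n
  height-bound z n with Q z ≤? P z
  ... | yes Qz≤Pz = escaping-height-bound z n Qz≤Pz
  ... | no  Qz≰Pz = bounded-height-bound z n (≰⇒> Qz≰Pz)

-- The bound holds for every n and every k.
lemma2p6 : (d : ℕ) → 3 ≤ d → (a : Fin (suc d) → ℤ) → Admissible d a → (z : ℚ) →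
    (k : ℕ) → 1 ≤ k → ∃[ N ] ((n : ℕ) → N ≤ n →
      Hℚ z ^ (2 * d ^ n) * k ^ (2 * d ^ n)
        ≤ Hℚ (iter (ψ d a) n z) ^ 2 * (k + 1) ^ (2 * d ^ n) * (Hψ d a * (d * d)) ^ (d ^ n))
lemma2p6 d 3≤d a adm z k _ = 0 , λ n _ → bound n
  where
  open HeightBound 3≤d adm using (K; height-bound)
  bound : ∀ n → Hℚ z ^ (2 * d ^ n) * k ^ (2 * d ^ n) ≤ Hℚ (iter (ψ d a) n z) ^ 2 * (k + 1) ^ (2 * d ^ n) * K ^ d ^ n
  bound n = begin
    Hℚ z ^ (2 * d ^ n) * k ^ (2 * d ^ n)            ≡⟨ cong (_* k ^ (2 * d ^ n)) (trans (^-*-comm (Hℚ z) (d ^ n) 2) (^-*-assoc (Hℚ z) 2 (d ^ n))) ⟨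
    (Hℚ z ^ d ^ n) ^ 2 * k ^ (2 * d ^ n)            ≤⟨ *-mono-≤ (height-bound z n) (^-monoˡ-≤ (2 * d ^ n) (m≤m+n k 1)) ⟩
    Hℚ zₙ ^ 2 * K ^ d ^ n * (k + 1) ^ (2 * d ^ n)   ≡⟨ xy∙z≈xz∙y (Hℚ zₙ ^ 2) (K ^ d ^ n) _ ⟩
    Hℚ zₙ ^ 2 * (k + 1) ^ (2 * d ^ n) * K ^ d ^ n   ∎
    where
    open ≤-Reasoning
    zₙ = iter (ψ d a) n z
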